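{- Let $S=\{(1,1),(1,2),(2,1)\}$. For all integers $\ell_1,\ell_2\ge 0$, $$a_S(\ell_1,\ell_2)=\sum_{k=\lceil \max\{\ell_1,\ell_2\}/2\rceil}^{\min\{\ell_1,\ell_2\}}\ \sum_{j\ge 0}(-1)^j\binom{k}{j}\binom{k-j}{\ell_1-k-j}\binom{k-j}{\ell_2-k-j}.$$
   Context: For $S\subseteq\mathbb{N}^2$, $a_S(\ell_1,\ell_2)$ is the number of $2\times k$ matrices (over all $k\ge 0$) with non-negative integer entries whose first row sums to $\ell_1$, whose second row sums to $\ell_2$, and each of whose columns lies in $S$; for $(\ell_1,\ell_2)=(0,0)$ the empty matrix ($k=0$) is counted, so $a_S(0,0)=1$. Binomial coefficients $\binom{n}{m}$ with $n\ge 0$ are $0$ when $m<0$ or $m>n$. -}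

module Defs where

open import Data.Nat using (ℕ; zero; suc; _+_; _∸_; _⊔_; _⊓_; ⌈_/2⌉)
open import Data.Nat.Combinatorics using (_C_)
open import Data.Integer using (ℤ; +_; -[1+_]; -_) renaming (_+_ to _+ℤ_; _*_ to _*ℤ_; _-_ to _-ℤ_)
open import Data.List using (List; []; _∷_; map; upTo; foldr)
open import Data.List.Relation.Unary.All using (All)
open import Data.Product using (Σ; _×_; _,_; proj₁; proj₂)
open import Relation.Binary.PropositionalEquality using (_≡_)

-- A 2×k matrix with ℕ entries, represented as its list of columns (k = length).
Matrix2 : Set
Matrix2 = List (ℕ × ℕ)

row₁ row₂ : Matrix2 → ℕ
row₁ cs = foldr (λ c s → proj₁ c + s) 0 cs
row₂ cs = foldr (λ c s → proj₂ c + s) 0 cs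

-- The type of 2×k matrices (any k ≥ 0) whose columns all lie in S,
-- with first row summing to ℓ₁ and second row summing to ℓ₂.
-- a_S(ℓ₁,ℓ₂) is the cardinality of this type.
Mats : (S : ℕ × ℕ → Set) → ℕ → ℕ → Set
Mats S ℓ₁ ℓ₂ = Σ Matrix2 λ cs → All S cs × (row₁ cs ≡ ℓ₁) × (row₂ cs ≡ ℓ₂)

data S₆ : ℕ × ℕ → Set where
  c11 : S₆ (1 , 1)
  c12 : S₆ (1 , 2)
  c21 : S₆ (2 , 1)

-- binomial n m with n ∈ ℕ and m ∈ ℤ; zero for m < 0 (and for m > n, by _C_)
binomℤ : ℕ → ℤ → ℤ
binomℤ n (+ m)    = + (n C m)
binomℤ n -[1+ _ ] = + 0

sign : ℕ → ℤ
sign zero          = + 1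
sign (suc zero)    = - (+ 1)
sign (suc (suc j)) = sign j

sumℤ : List ℤ → ℤ
sumℤ = foldr _+ℤ_ (+ 0)

-- the list [a, a+1, ..., b]  (empty if b < a)
range : ℕ → ℕ → List ℕ
range a b = map (λ i → a + i) (upTo (suc b ∸ a))

-- inner sum over j ≥ 0; terms with j > k vanish since binom(k,j) = 0
inner : ℕ → ℕ → ℕ → ℤ
inner ℓ₁ ℓ₂ k = sumℤ (map term (range 0 k))
  where
  term : ℕ → ℤ
  term j = sign j *ℤ (+ (k C j))
             *ℤ binomℤ (k ∸ j) (+ ℓ₁ -ℤ + k -ℤ + j)
             *ℤ binomℤ (k ∸ j) (+ ℓ₂ -ℤ + k -ℤ + j)

formula : ℕ → ℕ → ℤ
formula ℓ₁ ℓ₂ = sumℤ (map (inner ℓ₁ ℓ₂) (range ⌈ ℓ₁ ⊔ ℓ₂ /2⌉ (ℓ₁ ⊓ ℓ₂)))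

module Submission where

-- Let t k ℓ₁ ℓ₂ count the matrices with exactly k columns.  Removing the first
-- column gives t (k+1) (ℓ₁+1) (ℓ₂+1) = t k ℓ₁ ℓ₂ + t k ℓ₁ (ℓ₂-1) + t k (ℓ₁-1) ℓ₂,
-- and the same decomposition is an explicit bijection between the matrices and
-- Fin (N ℓ₁ ℓ₂), where N ℓ₁ ℓ₂ = Σ_k t k ℓ₁ ℓ₂.  A matrix with k columns and row
-- sums k + c, k + b has exactly c columns (2,1) and b columns (1,2), and indeed
-- the closed form t k (k+c) (k+b) = C(k,c)·C(k-c,b) satisfies the recursion.
-- On the side of the formula, trinomial revision C(k,j)·C(k-j,c-j) = C(k,c)·C(c,j)
-- and the alternating identity Σ_j (-1)^j C(c,j)·C(k-j,b-j) = C(k-c,b) evaluate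
-- the inner sum over j to t k ℓ₁ ℓ₂.  Finally t k ℓ₁ ℓ₂ vanishes unless
-- ⌈max(ℓ₁,ℓ₂)/2⌉ ≤ k ≤ min(ℓ₁,ℓ₂), so the outer sum of the formula is N ℓ₁ ℓ₂.

open import Defs
open import Data.Nat
  using (ℕ; zero; suc; _+_; _*_; _∸_; _!; _<_; _≤_; z≤n; s≤s; _<?_; _≤?_; _⊔_; _⊓_; ⌈_/2⌉; NonZero)
open import Data.Nat.Properties
open import Data.Nat.Combinatorics
  using (_C_; nCk≡n!/k![n-k]!; k>n⇒nCk≡0; k![n∸k]!∣n!; nCk+nC[k+1]≡[n+1]C[k+1])
open import Data.Nat.DivMod using (_/_; m/n*n≡m)
open import Data.Nat.Tactic.RingSolver using (solve-∀)
open import Algebra.Properties.CommutativeSemigroup +-commutativeSemigroup using (interchange)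
open import Data.Integer using (ℤ; +_; -_; _⊖_)
  renaming (_+_ to _+ℤ_; _*_ to _*ℤ_; _-_ to _-ℤ_)
import Data.Integer.Properties as ℤ
import Data.Integer.Tactic.RingSolver as ℤ-Solver
open import Data.Fin using (Fin)
open import Data.Fin.Properties using (+↔⊎; 1↔⊤)
open import Data.List using ([]; _∷_; map; applyUpTo)
open import Data.List.Relation.Unary.All using ([]; _∷_)
open import Data.Product using (Σ; _×_; _,_)
open import Data.Sum using (_⊎_; inj₁; inj₂)
open import Data.Sum.Function.Propositional using (_⊎-↔_)
open import Data.Empty using (⊥; ⊥-elim)
open import Data.Unit using (⊤; tt)
open import Function.Bundles using (_↔_; mk↔ₛ′)
open import Function.Properties.Inverse using (↔-trans; ↔-sym; ↔-refl)
open import Relation.Binary.PropositionalEquality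
  using (_≡_; refl; sym; trans; cong; cong₂; subst; module ≡-Reasoning)
open import Relation.Nullary using (Dec; yes; no)

-- f at the predecessor of n, and 0 at n = 0.  Recursions such as
-- N(ℓ₁+1, ℓ₂+1) = N(ℓ₁,ℓ₂) + N(ℓ₁,ℓ₂-1) + N(ℓ₁-1,ℓ₂), with the convention
-- that N vanishes at -1, are written with it.
at-pred : (ℕ → ℕ) → ℕ → ℕ
at-pred f zero    = 0
at-pred f (suc n) = f n

at-pred-vanishing : ∀ f n → (∀ m → m < n → f m ≡ 0) → at-pred f n ≡ 0
at-pred-vanishing f zero    _      = refl
at-pred-vanishing f (suc n) vanish = vanish n ≤-refl

at-pred-* : ∀ a f n → at-pred (λ m → a * f m) n ≡ a * at-pred f n
at-pred-* a f zero    = sym (*-zeroʳ a)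
at-pred-* a f (suc n) = refl

at-pred-+ : ∀ k (f g : ℕ → ℕ) → (∀ m → m < k → f m ≡ 0) → (∀ m → f (k + m) ≡ g m) →
            ∀ n → at-pred f (k + n) ≡ at-pred g n
at-pred-+ zero    f g vanish shift zero    = refl
at-pred-+ (suc k) f g vanish shift zero    = vanish (k + 0) (s≤s (≤-reflexive (+-identityʳ k)))
at-pred-+ k       f g vanish shift (suc n) = trans (cong (at-pred f) (+-suc k n)) (shift n)

sumℕ : ℕ → (ℕ → ℕ) → ℕ
sumℕ zero    f = 0
sumℕ (suc n) f = f 0 + sumℕ n (λ i → f (suc i))

sumℕ-+ : ∀ n f g → sumℕ n (λ i → f i + g i) ≡ sumℕ n f + sumℕ n g
sumℕ-+ zero    f g = refl
sumℕ-+ (suc n) f g = trans (cong (_+_ (f 0 + g 0)) (sumℕ-+ n _ _)) (interchange (f 0) (g 0) _ _)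

sumℕ-vanishing : ∀ n f → (∀ i → i < n → f i ≡ 0) → sumℕ n f ≡ 0
sumℕ-vanishing zero    f vanish = refl
sumℕ-vanishing (suc n) f vanish =
  cong₂ _+_ (vanish 0 (s≤s z≤n)) (sumℕ-vanishing n _ (λ i i<n → vanish (suc i) (s≤s i<n)))

sumℕ-split : ∀ a n f → sumℕ (a + n) f ≡ sumℕ a f + sumℕ n (λ i → f (a + i))
sumℕ-split zero    n f = refl
sumℕ-split (suc a) n f =
  trans (cong (_+_ (f 0)) (sumℕ-split a n (λ i → f (suc i)))) (sym (+-assoc (f 0) _ _))

sumℕ-at-pred : ∀ n (f : ℕ → ℕ → ℕ) m →
               sumℕ n (λ i → at-pred (f i) m) ≡ at-pred (λ m → sumℕ n (λ i → f i m)) m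
sumℕ-at-pred n f zero    = sumℕ-vanishing n _ (λ _ _ → refl)
sumℕ-at-pred n f (suc m) = refl

sumℕ-window : ∀ lo m e f → (∀ i → i < lo → f i ≡ 0) → (∀ i → f (lo + (m + i)) ≡ 0) →
              sumℕ (lo + (m + e)) f ≡ sumℕ m (λ i → f (lo + i))
sumℕ-window lo m e f below above = begin
  sumℕ (lo + (m + e)) f
    ≡⟨ sumℕ-split lo (m + e) f ⟩
  sumℕ lo f + sumℕ (m + e) (λ i → f (lo + i))
    ≡⟨ cong₂ _+_ (sumℕ-vanishing lo f below) (sumℕ-split m e _) ⟩
  sumℕ m (λ i → f (lo + i)) + sumℕ e (λ i → f (lo + (m + i)))
    ≡⟨ cong (_+_ (sumℕ m (λ i → f (lo + i)))) (sumℕ-vanishing e _ (λ i _ → above i)) ⟩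
  sumℕ m (λ i → f (lo + i)) + 0
    ≡⟨ +-identityʳ _ ⟩
  sumℕ m (λ i → f (lo + i)) ∎
  where open ≡-Reasoning

Σℤ : ℕ → (ℕ → ℤ) → ℤ
Σℤ zero    f = + 0
Σℤ (suc n) f = f 0 +ℤ Σℤ n (λ i → f (suc i))

Σℤ-cong : ∀ n {f g : ℕ → ℤ} → (∀ j → j < n → f j ≡ g j) → Σℤ n f ≡ Σℤ n g
Σℤ-cong zero    eq = refl
Σℤ-cong (suc n) eq = cong₂ _+ℤ_ (eq 0 (s≤s z≤n)) (Σℤ-cong n (λ j j<n → eq (suc j) (s≤s j<n)))

Σℤ-vanishing : ∀ n {f : ℕ → ℤ} → (∀ j → f j ≡ + 0) → Σℤ n f ≡ + 0
Σℤ-vanishing zero    vanish = refl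
Σℤ-vanishing (suc n) vanish = cong₂ _+ℤ_ (vanish 0) (Σℤ-vanishing n (λ j → vanish (suc j)))

Σℤ-- : ∀ n (f g : ℕ → ℤ) → Σℤ n (λ i → f i -ℤ g i) ≡ Σℤ n f -ℤ Σℤ n g
Σℤ-- zero    f g = refl
Σℤ-- (suc n) f g = trans (cong ((f 0 -ℤ g 0) +ℤ_) (Σℤ-- n _ _)) (regroup (f 0) (g 0) _ _)
  where
  regroup : ∀ a b c d → a -ℤ b +ℤ (c -ℤ d) ≡ a +ℤ c -ℤ (b +ℤ d)
  regroup = ℤ-Solver.solve-∀

Σℤ-*ˡ : ∀ n x (f : ℕ → ℤ) → Σℤ n (λ i → x *ℤ f i) ≡ x *ℤ Σℤ n f
Σℤ-*ˡ zero    x f = sym (ℤ.*-zeroʳ x)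
Σℤ-*ˡ (suc n) x f = trans (cong (x *ℤ f 0 +ℤ_) (Σℤ-*ˡ n x _)) (sym (ℤ.*-distribˡ-+ x (f 0) _))

Σℤ-pos : ∀ n (f : ℕ → ℕ) → Σℤ n (λ i → + f i) ≡ + sumℕ n f
Σℤ-pos zero    f = refl
Σℤ-pos (suc n) f = trans (cong (+ f 0 +ℤ_) (Σℤ-pos n _)) (sym (ℤ.pos-+ (f 0) _))

sumℤ-range : ∀ a b (f : ℕ → ℤ) → sumℤ (map f (range a b)) ≡ Σℤ (suc b ∸ a) (λ i → f (a + i))
sumℤ-range a b f = go (suc b ∸ a) (λ i → i)
  where
  go : ∀ n g → sumℤ (map f (map (_+_ a) (applyUpTo g n))) ≡ Σℤ n (λ i → f (a + g i))
  go zero    g = refl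
  go (suc n) g = cong (f (a + g 0) +ℤ_) (go n (λ i → g (suc i)))

sign-suc : ∀ j → sign (suc j) ≡ - sign j
sign-suc zero    = refl
sign-suc (suc j) = trans (sym (ℤ.neg-involutive (sign j))) (cong -_ (sym (sign-suc j)))

data Offset (k : ℕ) : ℕ → Set where
  below : ∀ {l} → l < k → Offset k l
  above : ∀ c → Offset k (k + c)

offset : ∀ k l → Offset k l
offset zero    l       = above l
offset (suc k) zero    = below (s≤s z≤n)
offset (suc k) (suc l) with offset k l
... | below l<k = below (s≤s l<k)
... | above c   = above c

pascal : ∀ n b → suc n C b ≡ n C b + at-pred (n C_) b
pascal n zero    = refl
pascal n (suc b) = trans (sym (nCk+nC[k+1]≡[n+1]C[k+1] n b)) (+-comm (n C b) (n C suc b))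

-- Pascal's rule for C(n-m, b) inside the product C(n, m+1)·C(n-m, b); when
-- m ≥ n the first factor vanishes, so no hypothesis on m is needed.
pascal-guarded : ∀ n m b → (n C suc m) * ((n ∸ m) C b)
                         ≡ (n C suc m) * ((n ∸ suc m) C b + at-pred ((n ∸ suc m) C_) b)
pascal-guarded n m b with m <? n
... | yes m<n = cong (_*_ (n C suc m)) (trans (cong (_C b) (+-∸-assoc 1 m<n)) (pascal (n ∸ suc m) b))
... | no  m≮n rewrite k>n⇒nCk≡0 (s≤s (≮⇒≥ m≮n)) = refl

C-factorial : ∀ a b → ((a + b) C a) * (a ! * b !) ≡ (a + b) !
C-factorial a b = begin
  ((a + b) C a) * (a ! * b !)
    ≡⟨ cong (λ x → ((a + b) C a) * (a ! * x !)) (sym (m+n∸m≡n a b)) ⟩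
  ((a + b) C a) * (a ! * (a + b ∸ a) !)
    ≡⟨ cong (_* (a ! * (a + b ∸ a) !)) (nCk≡n!/k![n-k]! (m≤m+n a b)) ⟩
  ((a + b) ! / (a ! * (a + b ∸ a) !)) * (a ! * (a + b ∸ a) !)
    ≡⟨ m/n*n≡m (k![n∸k]!∣n! (m≤m+n a b)) ⟩
  (a + b) ! ∎
  where
  open ≡-Reasoning
  instance _ = a !* (a + b ∸ a) !≢0

-- Choosing j elements and then d more from the remaining d + e is the same as
-- choosing j + d elements and then the first j among them.
subset-of-subset : ∀ j d e → ((j + (d + e)) C j) * ((d + e) C d)
                           ≡ ((j + d + e) C (j + d)) * ((j + d) C j)
subset-of-subset j d e = *-cancelʳ-≡ _ _ (j ! * (d ! * e !)) (trans by-j-first (sym by-j+d-first))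
  where
  open ≡-Reasoning
  instance
    _ : NonZero (j ! * (d ! * e !))
    _ = m*n≢0 _ _ {{j !≢0}} {{m*n≢0 _ _ {{d !≢0}} {{e !≢0}}}}
  regroup₁ : ∀ a b x y z → a * b * (x * (y * z)) ≡ a * (x * (b * (y * z)))
  regroup₁ = solve-∀
  regroup₂ : ∀ a b x y z → a * b * (x * (y * z)) ≡ a * (b * (x * y) * z)
  regroup₂ = solve-∀
  by-j-first : ((j + (d + e)) C j) * ((d + e) C d) * (j ! * (d ! * e !)) ≡ (j + (d + e)) !
  by-j-first = begin
    ((j + (d + e)) C j) * ((d + e) C d) * (j ! * (d ! * e !))
      ≡⟨ regroup₁ ((j + (d + e)) C j) ((d + e) C d) (j !) (d !) (e !) ⟩
    ((j + (d + e)) C j) * (j ! * (((d + e) C d) * (d ! * e !)))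
      ≡⟨ cong (λ x → ((j + (d + e)) C j) * (j ! * x)) (C-factorial d e) ⟩
    ((j + (d + e)) C j) * (j ! * (d + e) !)
      ≡⟨ C-factorial j (d + e) ⟩
    (j + (d + e)) ! ∎
  by-j+d-first : ((j + d + e) C (j + d)) * ((j + d) C j) * (j ! * (d ! * e !)) ≡ (j + (d + e)) !
  by-j+d-first = begin
    ((j + d + e) C (j + d)) * ((j + d) C j) * (j ! * (d ! * e !))
      ≡⟨ regroup₂ ((j + d + e) C (j + d)) ((j + d) C j) (j !) (d !) (e !) ⟩
    ((j + d + e) C (j + d)) * (((j + d) C j) * (j ! * d !) * e !)
      ≡⟨ cong (λ x → ((j + d + e) C (j + d)) * (x * e !)) (C-factorial j d) ⟩
    ((j + d + e) C (j + d)) * ((j + d) ! * e !)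
      ≡⟨ C-factorial (j + d) e ⟩
    (j + d + e) !
      ≡⟨ cong _! (+-assoc j d e) ⟩
    (j + (d + e)) ! ∎

-- The binomial coefficient with a difference as lower index:
-- n C[ a - b ] = C(n, a - b) if b ≤ a, and 0 otherwise.  It is the natural
-- number counterpart of binomℤ n (a - b) in the formula.
infix 8 _C[_-_]
_C[_-_] : ℕ → ℕ → ℕ → ℕ
n C[ a     - zero  ] = n C a
n C[ zero  - suc b ] = 0
n C[ suc a - suc b ] = n C[ a - b ]

C[-]-below : ∀ n {a b} → a < b → n C[ a - b ] ≡ 0
C[-]-below n {zero}  {suc b} _         = refl
C[-]-below n {suc a} {suc b} (s≤s a<b) = C[-]-below n a<b

C[-]-cancel : ∀ n k a b → n C[ k + a - k + b ] ≡ n C[ a - b ]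
C[-]-cancel n zero    a b = refl
C[-]-cancel n (suc k) a b = C[-]-cancel n k a b

C[-]-offset : ∀ n j d → n C[ j + d - j ] ≡ n C d
C[-]-offset n j d = trans (cong (λ x → n C[ j + d - x ]) (sym (+-identityʳ j))) (C[-]-cancel n j d 0)

binomℤ-⊖ : ∀ n a b → binomℤ n (a ⊖ b) ≡ + (n C[ a - b ])
binomℤ-⊖ n a       zero    = refl
binomℤ-⊖ n zero    (suc b) = refl
binomℤ-⊖ n (suc a) (suc b) = trans (cong (binomℤ n) (ℤ.[1+m]⊖[1+n]≡m⊖n a b)) (binomℤ-⊖ n a b)

trinomial-revision : ∀ k c j → j ≤ k → (k C j) * (k ∸ j) C[ c - j ] ≡ (k C c) * (c C j)
trinomial-revision k c j j≤k with offset j c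
... | below c<j = begin
  (k C j) * (k ∸ j) C[ c - j ] ≡⟨ cong (_*_ (k C j)) (C[-]-below (k ∸ j) c<j) ⟩
  (k C j) * 0                  ≡⟨ *-zeroʳ (k C j) ⟩
  0                            ≡⟨ *-zeroʳ (k C c) ⟨
  (k C c) * 0                  ≡⟨ cong (_*_ (k C c)) (k>n⇒nCk≡0 c<j) ⟨
  (k C c) * (c C j)            ∎
  where open ≡-Reasoning
... | above d with offset (j + d) k
...   | below k<j+d = begin
  (k C j) * (k ∸ j) C[ j + d - j ] ≡⟨ cong (_*_ (k C j)) (trans (C[-]-offset (k ∸ j) j d) (k>n⇒nCk≡0 k∸j<d)) ⟩
  (k C j) * 0                      ≡⟨ *-zeroʳ (k C j) ⟩
  0                                ≡⟨ cong (_* ((j + d) C j)) (k>n⇒nCk≡0 k<j+d) ⟨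
  (k C (j + d)) * ((j + d) C j)    ∎
  where
  open ≡-Reasoning
  k∸j<d : k ∸ j < d
  k∸j<d = +-cancelˡ-< j _ _ (subst (_< j + d) (sym (m+[n∸m]≡n j≤k)) k<j+d)
...   | above e = begin
  ((j + d + e) C j) * (j + d + e ∸ j) C[ j + d - j ]
    ≡⟨ cong₂ _*_ (cong (_C j) (+-assoc j d e)) (trans (C[-]-offset _ j d) (cong (_C d) (j+d+e∸j≡d+e))) ⟩
  ((j + (d + e)) C j) * ((d + e) C d)
    ≡⟨ subset-of-subset j d e ⟩
  ((j + d + e) C (j + d)) * ((j + d) C j) ∎
  where
  open ≡-Reasoning
  j+d+e∸j≡d+e : j + d + e ∸ j ≡ d + e
  j+d+e∸j≡d+e = trans (cong (_∸ j) (+-assoc j d e)) (m+n∸m≡n j (d + e))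

signed-pascal : ∀ c i w → sign (suc i) *ℤ + ((suc c C suc i) * w)
                        ≡ sign (suc i) *ℤ + ((c C suc i) * w) -ℤ sign i *ℤ + ((c C i) * w)
signed-pascal c i w = begin
  sign (suc i) *ℤ + ((suc c C suc i) * w)
    ≡⟨ cong₂ (λ s x → s *ℤ + (x * w)) (sign-suc i) (sym (nCk+nC[k+1]≡[n+1]C[k+1] c i)) ⟩
  (- sign i) *ℤ + (((c C i) + (c C suc i)) * w)
    ≡⟨ cong (_*ℤ_ (- sign i))
         (trans (ℤ.pos-* ((c C i) + (c C suc i)) w) (cong (_*ℤ + w) (ℤ.pos-+ (c C i) (c C suc i)))) ⟩
  (- sign i) *ℤ ((+ (c C i) +ℤ + (c C suc i)) *ℤ + w)
    ≡⟨ distribute (sign i) (+ (c C i)) (+ (c C suc i)) (+ w) ⟩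
  (- sign i) *ℤ (+ (c C suc i) *ℤ + w) -ℤ sign i *ℤ (+ (c C i) *ℤ + w)
    ≡⟨ cong₂ (λ s x → s *ℤ x -ℤ sign i *ℤ (+ (c C i) *ℤ + w))
             (sym (sign-suc i)) (sym (ℤ.pos-* (c C suc i) w)) ⟩
  sign (suc i) *ℤ + ((c C suc i) * w) -ℤ sign i *ℤ (+ (c C i) *ℤ + w)
    ≡⟨ cong (λ x → sign (suc i) *ℤ + ((c C suc i) * w) -ℤ sign i *ℤ x) (sym (ℤ.pos-* (c C i) w)) ⟩
  sign (suc i) *ℤ + ((c C suc i) * w) -ℤ sign i *ℤ + ((c C i) * w) ∎
  where
  open ≡-Reasoning
  distribute : ∀ s a a′ x → (- s) *ℤ ((a +ℤ a′) *ℤ x) ≡ (- s) *ℤ (a′ *ℤ x) -ℤ s *ℤ (a *ℤ x)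
  distribute = ℤ-Solver.solve-∀

-- The alternating identity Σ_{j ≤ k} (-1)^j C(c, j) C(k-j, b-j) = C(k-c, b)
-- for c ≤ k, by induction on c: Pascal's rule in c splits the sum into the
-- case c - 1 at k and, shifted by one index, the case c - 1 at k - 1, b - 1.
alternating : ∀ c k b → c ≤ k →
  Σℤ (suc k) (λ j → sign j *ℤ + ((c C j) * (k ∸ j) C[ b - j ])) ≡ + ((k ∸ c) C b)
alternating zero k b _ = trans (cong₂ _+ℤ_ first rest) (ℤ.+-identityʳ (+ (k C b)))
  where
  first : + 1 *ℤ + (1 * (k C b)) ≡ + (k C b)
  first = trans (ℤ.*-identityˡ _) (cong +_ (*-identityˡ (k C b)))
  rest : Σℤ k (λ j → sign (suc j) *ℤ + ((0 C suc j) * (k ∸ suc j) C[ b - suc j ])) ≡ + 0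
  rest = Σℤ-vanishing k (λ j → ℤ.*-zeroʳ (sign (suc j)))
alternating (suc c) (suc k) b (s≤s c≤k) = begin
  F 0 +ℤ Σℤ (suc k) (λ i → F (suc i))
    ≡⟨ cong (_+ℤ_ (F 0)) (Σℤ-cong (suc k) (λ i _ → signed-pascal c i ((k ∸ i) C[ b - suc i ]))) ⟩
  G 0 +ℤ Σℤ (suc k) (λ i → G (suc i) -ℤ H i)
    ≡⟨ cong (_+ℤ_ (G 0)) (Σℤ-- (suc k) (λ i → G (suc i)) H) ⟩
  G 0 +ℤ (Σℤ (suc k) (λ i → G (suc i)) -ℤ Σℤ (suc k) H)
    ≡⟨ ℤ.+-assoc (G 0) _ _ ⟨
  Σℤ (suc (suc k)) G -ℤ Σℤ (suc k) H
    ≡⟨ cong₂ _-ℤ_ (alternating c (suc k) b (m≤n⇒m≤1+n c≤k)) (shifted b) ⟩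
  + ((suc k ∸ c) C b) -ℤ + at-pred ((k ∸ c) C_) b
    ≡⟨ cong (λ n → + (n C b) -ℤ + at-pred ((k ∸ c) C_) b) (+-∸-assoc 1 c≤k) ⟩
  + (suc (k ∸ c) C b) -ℤ + at-pred ((k ∸ c) C_) b
    ≡⟨ cong (λ n → + n -ℤ + at-pred ((k ∸ c) C_) b) (pascal (k ∸ c) b) ⟩
  + ((k ∸ c) C b + at-pred ((k ∸ c) C_) b) -ℤ + at-pred ((k ∸ c) C_) b
    ≡⟨ cong (_-ℤ + at-pred ((k ∸ c) C_) b) (ℤ.pos-+ ((k ∸ c) C b) _) ⟩
  + ((k ∸ c) C b) +ℤ + at-pred ((k ∸ c) C_) b -ℤ + at-pred ((k ∸ c) C_) b
    ≡⟨ cancel (+ ((k ∸ c) C b)) (+ at-pred ((k ∸ c) C_) b) ⟩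
  + ((k ∸ c) C b) ∎
  where
  open ≡-Reasoning
  F G H : ℕ → ℤ
  F j = sign j *ℤ + ((suc c C j) * (suc k ∸ j) C[ b - j ])
  G j = sign j *ℤ + ((c C j) * (suc k ∸ j) C[ b - j ])
  H i = sign i *ℤ + ((c C i) * (k ∸ i) C[ b - suc i ])
  shifted : ∀ b → Σℤ (suc k) (λ i → sign i *ℤ + ((c C i) * (k ∸ i) C[ b - suc i ]))
                ≡ + at-pred ((k ∸ c) C_) b
  shifted zero    = Σℤ-vanishing (suc k) (λ i →
    trans (cong (λ x → sign i *ℤ + x) (*-zeroʳ (c C i))) (ℤ.*-zeroʳ (sign i)))
  shifted (suc b) = alternating c k b c≤k
  cancel : ∀ x y → x +ℤ y -ℤ y ≡ x
  cancel = ℤ-Solver.solve-∀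

-- t k ℓ₁ ℓ₂ is the number of matrices with exactly k columns from S₆ and row
-- sums ℓ₁, ℓ₂, computed by removing the first column: (1,1), (1,2) or (2,1).
t : ℕ → ℕ → ℕ → ℕ
t zero    zero     zero     = 1
t zero    zero     (suc _)  = 0
t zero    (suc _)  _        = 0
t (suc k) zero     _        = 0
t (suc k) (suc _)  zero     = 0
t (suc k) (suc l₁) (suc l₂) = t k l₁ l₂ + at-pred (t k l₁) l₂ + at-pred (λ l → t k l l₂) l₁

-- Every column has entries ≥ 1, so there are at most ℓ₁ columns.
t-vanishes₁ : ∀ k l₁ l₂ → l₁ < k → t k l₁ l₂ ≡ 0
t-vanishes₁ (suc k) zero     l₂       _          = refl
t-vanishes₁ (suc k) (suc l₁) zero     _          = refl
t-vanishes₁ (suc k) (suc l₁) (suc l₂) (s≤s l₁<k) = cong₂ _+_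
  (cong₂ _+_ (t-vanishes₁ k l₁ l₂ l₁<k) (at-pred-vanishing _ l₂ (λ m _ → t-vanishes₁ k l₁ m l₁<k)))
  (at-pred-vanishing _ l₁ (λ l l<l₁ → t-vanishes₁ k l l₂ (<-trans l<l₁ l₁<k)))

t-vanishes₂ : ∀ k l₁ l₂ → l₂ < k → t k l₁ l₂ ≡ 0
t-vanishes₂ (suc k) zero     l₂       _          = refl
t-vanishes₂ (suc k) (suc l₁) zero     _          = refl
t-vanishes₂ (suc k) (suc l₁) (suc l₂) (s≤s l₂<k) = cong₂ _+_
  (cong₂ _+_ (t-vanishes₂ k l₁ l₂ l₂<k)
             (at-pred-vanishing _ l₂ (λ m m<l₂ → t-vanishes₂ k l₁ m (<-trans m<l₂ l₂<k))))
  (at-pred-vanishing _ l₁ (λ l _ → t-vanishes₂ k l l₂ l₂<k))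

-- The closed form of t: with k columns and row sums k + c, k + b there are
-- exactly c columns (2,1) and b columns (1,2), so t k (k+c) (k+b) = T k c b.
T : ℕ → ℕ → ℕ → ℕ
T k c b = (k C c) * ((k ∸ c) C b)

T-step : ∀ k c b → T (suc k) c b ≡ T k c b + at-pred (T k c) b + at-pred (λ c → T k c b) c
T-step k zero b = begin
  1 * (suc k C b)
    ≡⟨ cong (_*_ 1) (pascal k b) ⟩
  1 * ((k C b) + at-pred (k C_) b)
    ≡⟨ *-distribˡ-+ 1 (k C b) _ ⟩
  1 * (k C b) + 1 * at-pred (k C_) b
    ≡⟨ cong (_+_ (1 * (k C b))) (at-pred-* 1 (k C_) b) ⟨
  1 * (k C b) + at-pred (λ b → 1 * (k C b)) b
    ≡⟨ +-identityʳ _ ⟨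
  T k 0 b + at-pred (T k 0) b + 0 ∎
  where open ≡-Reasoning
T-step k (suc c) b = begin
  (suc k C suc c) * ((k ∸ c) C b)
    ≡⟨ cong (_* ((k ∸ c) C b)) (nCk+nC[k+1]≡[n+1]C[k+1] k c) ⟨
  ((k C c) + (k C suc c)) * ((k ∸ c) C b)
    ≡⟨ *-distribʳ-+ ((k ∸ c) C b) (k C c) (k C suc c) ⟩
  T k c b + (k C suc c) * ((k ∸ c) C b)
    ≡⟨ cong (_+_ (T k c b)) (pascal-guarded k c b) ⟩
  T k c b + (k C suc c) * ((k ∸ suc c) C b + at-pred ((k ∸ suc c) C_) b)
    ≡⟨ cong (_+_ (T k c b)) (*-distribˡ-+ (k C suc c) _ _) ⟩
  T k c b + (T k (suc c) b + (k C suc c) * at-pred ((k ∸ suc c) C_) b)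
    ≡⟨ cong (λ x → T k c b + (T k (suc c) b + x)) (at-pred-* (k C suc c) ((k ∸ suc c) C_) b) ⟨
  T k c b + (T k (suc c) b + at-pred (T k (suc c)) b)
    ≡⟨ +-comm (T k c b) _ ⟩
  T k (suc c) b + at-pred (T k (suc c)) b + T k c b ∎
  where open ≡-Reasoning

-- Both sides satisfy the same recursion in k and agree at k = 0.
t-closed : ∀ k c b → t k (k + c) (k + b) ≡ T k c b
t-closed zero    zero    zero    = refl
t-closed zero    zero    (suc b) = refl
t-closed zero    (suc c) b       = refl
t-closed (suc k) c       b       = begin
  t k (k + c) (k + b) + at-pred (t k (k + c)) (k + b) + at-pred (λ l → t k l (k + b)) (k + c)
    ≡⟨ cong₂ _+_ (cong₂ _+_ (t-closed k c b) second) third ⟩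
  T k c b + at-pred (T k c) b + at-pred (λ c → T k c b) c
    ≡⟨ T-step k c b ⟨
  T (suc k) c b ∎
  where
  open ≡-Reasoning
  second : at-pred (t k (k + c)) (k + b) ≡ at-pred (T k c) b
  second = at-pred-+ k _ _ (λ m m<k → t-vanishes₂ k (k + c) m m<k) (t-closed k c) b
  third : at-pred (λ l → t k l (k + b)) (k + c) ≡ at-pred (λ c → T k c b) c
  third = at-pred-+ k _ _ (λ m m<k → t-vanishes₁ k m (k + b) m<k) (λ m → t-closed k m b) c

-- a_S(ℓ₁, ℓ₂), summing over the possible numbers k ≤ ℓ₁ of columns.
N : ℕ → ℕ → ℕ
N l₁ l₂ = sumℕ (suc l₁) (λ k → t k l₁ l₂)

N-as-sum : ∀ {l₁} l₂ X → l₁ < X → sumℕ X (λ k → t k l₁ l₂) ≡ N l₁ l₂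
N-as-sum {l₁} l₂ X l₁<X with m≤n⇒∃[o]m+o≡n l₁<X
... | d , refl = sumℕ-window 0 (suc l₁) d (λ k → t k l₁ l₂) (λ _ ())
                   (λ i → t-vanishes₁ (suc l₁ + i) l₁ l₂ (m≤m+n (suc l₁) i))

N-step : ∀ l₁ l₂ → N (suc l₁) (suc l₂) ≡ N l₁ l₂ + at-pred (N l₁) l₂ + at-pred (λ l → N l l₂) l₁
N-step l₁ l₂ = begin
  sumℕ (suc l₁) (λ k → first-11 k + first-12 k + first-21 k)
    ≡⟨ sumℕ-+ (suc l₁) (λ k → first-11 k + first-12 k) first-21 ⟩
  sumℕ (suc l₁) (λ k → first-11 k + first-12 k) + sumℕ (suc l₁) first-21
    ≡⟨ cong (_+ sumℕ (suc l₁) first-21) (sumℕ-+ (suc l₁) first-11 first-12) ⟩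
  N l₁ l₂ + sumℕ (suc l₁) first-12 + sumℕ (suc l₁) first-21
    ≡⟨ cong₂ (λ x y → N l₁ l₂ + x + y) (sumℕ-at-pred (suc l₁) (λ k → t k l₁) l₂)
             (trans (sumℕ-at-pred (suc l₁) (λ k l → t k l l₂) l₁) (fewer-columns l₁)) ⟩
  N l₁ l₂ + at-pred (N l₁) l₂ + at-pred (λ l → N l l₂) l₁ ∎
  where
  open ≡-Reasoning
  -- the matrices with k + 1 columns, by first column (1,1), (1,2), (2,1)
  first-11 first-12 first-21 : ℕ → ℕ
  first-11 k = t k l₁ l₂
  first-12 k = at-pred (t k l₁) l₂
  first-21 k = at-pred (λ l → t k l l₂) l₁
  fewer-columns : ∀ n → at-pred (λ l → sumℕ (suc n) (λ k → t k l l₂)) n ≡ at-pred (λ l → N l l₂) n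
  fewer-columns zero    = refl
  fewer-columns (suc l) = N-as-sum l₂ (suc (suc l)) (m<n⇒m<1+n (n<1+n l))

AtPred : (ℕ → Set) → ℕ → Set
AtPred F zero    = ⊥
AtPred F (suc n) = F n

toAtPred : ∀ (F : ℕ → Set) {m n} → suc m ≡ n → F m → AtPred F n
toAtPred F refl x = x

-- What remains of a matrix with row sums (ℓ₁+1, ℓ₂+1) after removing its
-- first column (1,1), (1,2) or (2,1) respectively.
Remainder : ℕ → ℕ → Set
Remainder l₁ l₂ = (Mats S₆ l₁ l₂ ⊎ AtPred (Mats S₆ l₁) l₂) ⊎ AtPred (λ l → Mats S₆ l l₂) l₁

first-column : ∀ l₁ l₂ → Mats S₆ (suc l₁) (suc l₂) ↔ Remainder l₁ l₂
first-column l₁ l₂ = mk↔ₛ′ remove (insert l₁ l₂) (remove-insert l₁ l₂) (insert-remove l₁ l₂)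
  where
  remove : ∀ {l₁ l₂} → Mats S₆ (suc l₁) (suc l₂) → Remainder l₁ l₂
  remove ([] , [] , () , _)
  remove ((_ ∷ cs) , (c11 ∷ a) , p₁ , p₂) = inj₁ (inj₁ (cs , a , suc-injective p₁ , suc-injective p₂))
  remove {l₁} ((_ ∷ cs) , (c12 ∷ a) , p₁ , p₂) =
    inj₁ (inj₂ (toAtPred (Mats S₆ l₁) (suc-injective p₂) (cs , a , suc-injective p₁ , refl)))
  remove {l₂ = l₂} ((_ ∷ cs) , (c21 ∷ a) , p₁ , p₂) =
    inj₂ (toAtPred (λ l → Mats S₆ l l₂) (suc-injective p₁) (cs , a , refl , suc-injective p₂))

  insert : ∀ l₁ l₂ → Remainder l₁ l₂ → Mats S₆ (suc l₁) (suc l₂)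
  insert l₁ l₂ (inj₁ (inj₁ (cs , a , p₁ , p₂))) =
    ((1 , 1) ∷ cs) , c11 ∷ a , cong suc p₁ , cong suc p₂
  insert l₁ (suc _) (inj₁ (inj₂ (cs , a , p₁ , p₂))) =
    ((1 , 2) ∷ cs) , c12 ∷ a , cong suc p₁ , cong (λ r → suc (suc r)) p₂
  insert (suc _) l₂ (inj₂ (cs , a , p₁ , p₂)) =
    ((2 , 1) ∷ cs) , c21 ∷ a , cong (λ r → suc (suc r)) p₁ , cong suc p₂

  remove-insert : ∀ l₁ l₂ x → remove (insert l₁ l₂ x) ≡ x
  remove-insert l₁ l₂      (inj₁ (inj₁ (cs , a , refl , refl))) = refl
  remove-insert l₁ (suc _) (inj₁ (inj₂ (cs , a , refl , refl))) = refl
  remove-insert (suc _) l₂ (inj₂ (cs , a , refl , refl))        = refl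

  insert-remove : ∀ l₁ l₂ x → insert l₁ l₂ (remove x) ≡ x
  insert-remove l₁ l₂ ([] , [] , () , _)
  insert-remove l₁ l₂ ((_ ∷ cs) , (c11 ∷ a) , refl , refl) = refl
  insert-remove l₁ l₂ ((_ ∷ cs) , (c12 ∷ a) , refl , refl) = refl
  insert-remove l₁ l₂ ((_ ∷ cs) , (c21 ∷ a) , refl , refl) = refl

-- Every column has both entries positive, so a matrix with a zero row sum is
-- the empty matrix, which has row sums (0, 0): the base cases of the bijection.
only-empty-matrix : Mats S₆ 0 0 ↔ ⊤
only-empty-matrix = mk↔ₛ′ (λ _ → tt) (λ _ → [] , [] , refl , refl) (λ _ → refl) unique
  where
  unique : ∀ x → ([] , [] , refl , refl) ≡ x
  unique ([] , [] , refl , refl) = refl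
  unique ((_ ∷ _) , (c11 ∷ _) , () , _)
  unique ((_ ∷ _) , (c12 ∷ _) , () , _)
  unique ((_ ∷ _) , (c21 ∷ _) , () , _)

no-matrix-0-suc : ∀ {l} → Mats S₆ 0 (suc l) → ⊥
no-matrix-0-suc ([] , [] , _ , ())
no-matrix-0-suc ((_ ∷ _) , (c11 ∷ _) , () , _)
no-matrix-0-suc ((_ ∷ _) , (c12 ∷ _) , () , _)
no-matrix-0-suc ((_ ∷ _) , (c21 ∷ _) , () , _)

no-matrix-suc-0 : ∀ {l} → Mats S₆ (suc l) 0 → ⊥
no-matrix-suc-0 ([] , [] , () , _)
no-matrix-suc-0 ((_ ∷ _) , (c11 ∷ _) , _ , ())
no-matrix-suc-0 ((_ ∷ _) , (c12 ∷ _) , _ , ())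
no-matrix-suc-0 ((_ ∷ _) , (c21 ∷ _) , _ , ())

empty↔Fin0 : ∀ {A : Set} → (A → ⊥) → A ↔ Fin 0
empty↔Fin0 ¬a = mk↔ₛ′ (λ a → ⊥-elim (¬a a)) (λ ()) (λ ()) (λ a → ⊥-elim (¬a a))

Fin-+³ : ∀ a b c → Fin (a + b + c) ↔ ((Fin a ⊎ Fin b) ⊎ Fin c)
Fin-+³ a b c = ↔-trans +↔⊎ (+↔⊎ ⊎-↔ ↔-refl)

↔Fin-cast : ∀ {A : Set} {m n} → m ≡ n → A ↔ Fin m → A ↔ Fin n
↔Fin-cast {A} eq = subst (λ n → A ↔ Fin n) eq

mutual
  Mats↔Fin : ∀ l₁ l₂ → Mats S₆ l₁ l₂ ↔ Fin (N l₁ l₂)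
  Mats↔Fin zero     zero     = ↔-trans only-empty-matrix (↔-sym 1↔⊤)
  Mats↔Fin zero     (suc l₂) = empty↔Fin0 no-matrix-0-suc
  Mats↔Fin (suc l₁) zero     =
    ↔Fin-cast (sym (sumℕ-vanishing (suc (suc l₁)) (λ k → t k (suc l₁) 0)
                                   (λ { zero _ → refl ; (suc k) _ → refl })))
              (empty↔Fin0 no-matrix-suc-0)
  Mats↔Fin (suc l₁) (suc l₂) = ↔Fin-cast (sym (N-step l₁ l₂))
    (↔-trans (first-column l₁ l₂)
      (↔-trans ((Mats↔Fin l₁ l₂ ⊎-↔ AtPred-Mats₂ l₁ l₂) ⊎-↔ AtPred-Mats₁ l₁ l₂)
        (↔-sym (Fin-+³ _ _ _))))

  AtPred-Mats₂ : ∀ l₁ l₂ → AtPred (Mats S₆ l₁) l₂ ↔ Fin (at-pred (N l₁) l₂)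
  AtPred-Mats₂ l₁ zero    = empty↔Fin0 (λ ())
  AtPred-Mats₂ l₁ (suc m) = Mats↔Fin l₁ m

  AtPred-Mats₁ : ∀ l₁ l₂ → AtPred (λ l → Mats S₆ l l₂) l₁ ↔ Fin (at-pred (λ l → N l l₂) l₁)
  AtPred-Mats₁ zero    l₂ = empty↔Fin0 (λ ())
  AtPred-Mats₁ (suc l) l₂ = Mats↔Fin l l₂

inner-summand : ℕ → ℕ → ℕ → ℕ → ℕ
inner-summand l₁ l₂ k j = (k C j) * (k ∸ j) C[ l₁ - k + j ] * (k ∸ j) C[ l₂ - k + j ]

inner-as-Σ : ∀ l₁ l₂ k → inner l₁ l₂ k ≡ Σℤ (suc k) (λ j → sign j *ℤ + inner-summand l₁ l₂ k j)
inner-as-Σ l₁ l₂ k = trans (sumℤ-range 0 k signed-term) (Σℤ-cong (suc k) (λ j _ → summand j))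
  where
  open ≡-Reasoning
  sub-sub : ∀ x y z → x -ℤ y -ℤ z ≡ x -ℤ (y +ℤ z)
  sub-sub = ℤ-Solver.solve-∀
  difference : ∀ a j → + a -ℤ + k -ℤ + j ≡ a ⊖ (k + j)
  difference a j = begin
    + a -ℤ + k -ℤ + j   ≡⟨ sub-sub (+ a) (+ k) (+ j) ⟩  + a -ℤ (+ k +ℤ + j)
                        ≡⟨ cong (λ x → + a -ℤ x) (ℤ.pos-+ k j) ⟨ + a -ℤ + (k + j)
                        ≡⟨ ℤ.m-n≡m⊖n a (k + j) ⟩  a ⊖ (k + j) ∎
  reassociate : ∀ s a b c → s *ℤ a *ℤ b *ℤ c ≡ s *ℤ (a *ℤ b *ℤ c)
  reassociate = ℤ-Solver.solve-∀
  signed-term : ℕ → ℤ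
  signed-term j = sign j *ℤ + (k C j) *ℤ binomℤ (k ∸ j) (+ l₁ -ℤ + k -ℤ + j)
                                      *ℤ binomℤ (k ∸ j) (+ l₂ -ℤ + k -ℤ + j)
  summand : ∀ j → signed-term j ≡ sign j *ℤ + inner-summand l₁ l₂ k j
  summand j = begin
    sign j *ℤ + (k C j) *ℤ binomℤ (k ∸ j) (+ l₁ -ℤ + k -ℤ + j) *ℤ binomℤ (k ∸ j) (+ l₂ -ℤ + k -ℤ + j)
      ≡⟨ cong₂ (λ x y → sign j *ℤ + (k C j) *ℤ x *ℤ y)
           (trans (cong (binomℤ (k ∸ j)) (difference l₁ j)) (binomℤ-⊖ (k ∸ j) l₁ (k + j)))
           (trans (cong (binomℤ (k ∸ j)) (difference l₂ j)) (binomℤ-⊖ (k ∸ j) l₂ (k + j))) ⟩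
    sign j *ℤ + (k C j) *ℤ + X *ℤ + Y
      ≡⟨ reassociate (sign j) (+ (k C j)) (+ X) (+ Y) ⟩
    sign j *ℤ (+ (k C j) *ℤ + X *ℤ + Y)
      ≡⟨ cong (_*ℤ_ (sign j)) (trans (ℤ.pos-* ((k C j) * X) Y) (cong (_*ℤ + Y) (ℤ.pos-* (k C j) X))) ⟨
    sign j *ℤ + inner-summand l₁ l₂ k j ∎
    where
    X = (k ∸ j) C[ l₁ - k + j ]
    Y = (k ∸ j) C[ l₂ - k + j ]

signed-zero : ∀ j {n} → n ≡ 0 → sign j *ℤ + n ≡ + 0
signed-zero j refl = ℤ.*-zeroʳ (sign j)

-- If ℓ₁ < k or ℓ₂ < k, every summand has a binomial with negative lower index.
inner-summand-vanishes₁ : ∀ {l₁} l₂ k j → l₁ < k → inner-summand l₁ l₂ k j ≡ 0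
inner-summand-vanishes₁ {l₁} l₂ k j l₁<k = begin
  (k C j) * (k ∸ j) C[ l₁ - k + j ] * (k ∸ j) C[ l₂ - k + j ]
    ≡⟨ cong (λ x → (k C j) * x * (k ∸ j) C[ l₂ - k + j ])
            (C[-]-below (k ∸ j) (<-≤-trans l₁<k (m≤m+n k j))) ⟩
  (k C j) * 0 * (k ∸ j) C[ l₂ - k + j ]
    ≡⟨ cong (_* (k ∸ j) C[ l₂ - k + j ]) (*-zeroʳ (k C j)) ⟩
  0 ∎
  where open ≡-Reasoning

inner-summand-vanishes₂ : ∀ l₁ {l₂} k j → l₂ < k → inner-summand l₁ l₂ k j ≡ 0
inner-summand-vanishes₂ l₁ {l₂} k j l₂<k = begin
  (k C j) * (k ∸ j) C[ l₁ - k + j ] * (k ∸ j) C[ l₂ - k + j ]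
    ≡⟨ cong (_*_ ((k C j) * (k ∸ j) C[ l₁ - k + j ]))
            (C[-]-below (k ∸ j) (<-≤-trans l₂<k (m≤m+n k j))) ⟩
  (k C j) * (k ∸ j) C[ l₁ - k + j ] * 0
    ≡⟨ *-zeroʳ ((k C j) * (k ∸ j) C[ l₁ - k + j ]) ⟩
  0 ∎
  where open ≡-Reasoning

-- For ℓ₁ = k + c and ℓ₂ = k + b, trinomial revision pulls C(k, c) out of every
-- summand and the alternating identity sums the rest to C(k-c, b).
inner-closed : ∀ k c b → Σℤ (suc k) (λ j → sign j *ℤ + inner-summand (k + c) (k + b) k j) ≡ + T k c b
inner-closed k c b = begin
  Σℤ (suc k) (λ j → sign j *ℤ + inner-summand (k + c) (k + b) k j)
    ≡⟨ Σℤ-cong (suc k) (λ j j≤k → revise j (≤-pred j≤k)) ⟩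
  Σℤ (suc k) (λ j → + (k C c) *ℤ R j)
    ≡⟨ Σℤ-*ˡ (suc k) (+ (k C c)) R ⟩
  + (k C c) *ℤ Σℤ (suc k) R
    ≡⟨ sum-R (c ≤? k) ⟩
  + T k c b ∎
  where
  open ≡-Reasoning
  R : ℕ → ℤ
  R j = sign j *ℤ + ((c C j) * (k ∸ j) C[ b - j ])
  swap : ∀ s x y → s *ℤ (x *ℤ y) ≡ x *ℤ (s *ℤ y)
  swap = ℤ-Solver.solve-∀
  revise : ∀ j → j ≤ k → sign j *ℤ + inner-summand (k + c) (k + b) k j ≡ + (k C c) *ℤ R j
  revise j j≤k = begin
    sign j *ℤ + ((k C j) * (k ∸ j) C[ k + c - k + j ] * (k ∸ j) C[ k + b - k + j ])
      ≡⟨ cong₂ (λ x y → sign j *ℤ + ((k C j) * x * y))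
               (C[-]-cancel (k ∸ j) k c j) (C[-]-cancel (k ∸ j) k b j) ⟩
    sign j *ℤ + ((k C j) * (k ∸ j) C[ c - j ] * (k ∸ j) C[ b - j ])
      ≡⟨ cong (λ x → sign j *ℤ + (x * (k ∸ j) C[ b - j ])) (trinomial-revision k c j j≤k) ⟩
    sign j *ℤ + ((k C c) * (c C j) * (k ∸ j) C[ b - j ])
      ≡⟨ cong (_*ℤ_ (sign j)) (trans (cong +_ (*-assoc (k C c) (c C j) _)) (ℤ.pos-* (k C c) _)) ⟩
    sign j *ℤ (+ (k C c) *ℤ + ((c C j) * (k ∸ j) C[ b - j ]))
      ≡⟨ swap (sign j) (+ (k C c)) _ ⟩
    + (k C c) *ℤ R j ∎
  sum-R : Dec (c ≤ k) → + (k C c) *ℤ Σℤ (suc k) R ≡ + T k c b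
  sum-R (yes c≤k) = trans (cong (_*ℤ_ (+ (k C c))) (alternating c k b c≤k)) (sym (ℤ.pos-* (k C c) _))
  sum-R (no  c≰k) rewrite k>n⇒nCk≡0 (≰⇒> c≰k) = ℤ.*-zeroˡ (Σℤ (suc k) R)

inner≡t : ∀ l₁ l₂ k → inner l₁ l₂ k ≡ + t k l₁ l₂
inner≡t l₁ l₂ k = trans (inner-as-Σ l₁ l₂ k) (evaluate (offset k l₁) (offset k l₂))
  where
  evaluate : Offset k l₁ → Offset k l₂ →
             Σℤ (suc k) (λ j → sign j *ℤ + inner-summand l₁ l₂ k j) ≡ + t k l₁ l₂
  evaluate (below l₁<k) _ =
    trans (Σℤ-vanishing (suc k) (λ j → signed-zero j (inner-summand-vanishes₁ l₂ k j l₁<k)))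
          (cong +_ (sym (t-vanishes₁ k l₁ l₂ l₁<k)))
  evaluate (above c) (below l₂<k) =
    trans (Σℤ-vanishing (suc k) (λ j → signed-zero j (inner-summand-vanishes₂ (k + c) k j l₂<k)))
          (cong +_ (sym (t-vanishes₂ k (k + c) l₂ l₂<k)))
  evaluate (above c) (above b) = trans (inner-closed k c b) (cong +_ (sym (t-closed k c b)))

-- Since every column sum is ≤ 2, a matrix with k columns has row sums ≤ 2k.
t-vanishes-double : ∀ k l₁ l₂ → k + k < l₁ ⊎ k + k < l₂ → t k l₁ l₂ ≡ 0
t-vanishes-double k l₁ l₂ large = go (offset k l₁) (offset k l₂) large
  where
  go : Offset k l₁ → Offset k l₂ → k + k < l₁ ⊎ k + k < l₂ → t k l₁ l₂ ≡ 0
  go (below l₁<k) _            _ = t-vanishes₁ k l₁ l₂ l₁<k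
  go (above c)    (below l₂<k) _ = t-vanishes₂ k (k + c) l₂ l₂<k
  go (above c)    (above b)    (inj₁ 2k<k+c) =
    trans (t-closed k c b) (cong (_* ((k ∸ c) C b)) (k>n⇒nCk≡0 (+-cancelˡ-< k k c 2k<k+c)))
  go (above c)    (above b)    (inj₂ 2k<k+b) =
    trans (t-closed k c b) (trans (cong (_*_ (k C c)) (k>n⇒nCk≡0 k∸c<b)) (*-zeroʳ (k C c)))
    where
    k∸c<b : k ∸ c < b
    k∸c<b = ≤-<-trans (m∸n≤m k c) (+-cancelˡ-< k k b 2k<k+b)

t-vanishes-below : ∀ l₁ l₂ k → k < ⌈ l₁ ⊔ l₂ /2⌉ → t k l₁ l₂ ≡ 0
t-vanishes-below l₁ l₂ k k<half = t-vanishes-double k l₁ l₂ (pick (⊔-sel l₁ l₂))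
  where
  2k<max : k + k < l₁ ⊔ l₂
  2k<max = ≰⇒> (λ max≤2k →
    <⇒≱ k<half (subst (⌈ l₁ ⊔ l₂ /2⌉ ≤_) (sym (n≡⌈n+n/2⌉ k)) (⌈n/2⌉-mono max≤2k)))
  pick : l₁ ⊔ l₂ ≡ l₁ ⊎ l₁ ⊔ l₂ ≡ l₂ → k + k < l₁ ⊎ k + k < l₂
  pick (inj₁ eq) = inj₁ (subst (k + k <_) eq 2k<max)
  pick (inj₂ eq) = inj₂ (subst (k + k <_) eq 2k<max)

t-vanishes-above : ∀ l₁ l₂ k → l₁ ⊓ l₂ < k → t k l₁ l₂ ≡ 0
t-vanishes-above l₁ l₂ k min<k with ⊓-sel l₁ l₂
... | inj₁ eq = t-vanishes₁ k l₁ l₂ (subst (_< k) eq min<k)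
... | inj₂ eq = t-vanishes₂ k l₁ l₂ (subst (_< k) eq min<k)

-- N equals the formula: both are Σ_k t k ℓ₁ ℓ₂, over ranges differing only by vanishing terms.
N≡formula : ∀ l₁ l₂ → + N l₁ l₂ ≡ formula l₁ l₂
N≡formula l₁ l₂ = begin
  + N l₁ l₂
    ≡⟨ cong +_ (N-as-sum l₂ X (≤-trans (m≤n+m (suc l₁) m) (m≤n+m _ lo))) ⟨
  + sumℕ X (λ k → t k l₁ l₂)
    ≡⟨ cong +_ (sumℕ-window lo m (suc l₁) _ (t-vanishes-below l₁ l₂) beyond-min) ⟩
  + sumℕ m (λ i → t (lo + i) l₁ l₂)
    ≡⟨ Σℤ-pos m _ ⟨
  Σℤ m (λ i → + t (lo + i) l₁ l₂)
    ≡⟨ Σℤ-cong m (λ i _ → inner≡t l₁ l₂ (lo + i)) ⟨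
  Σℤ m (λ i → inner l₁ l₂ (lo + i))
    ≡⟨ sumℤ-range lo (l₁ ⊓ l₂) (inner l₁ l₂) ⟨
  formula l₁ l₂ ∎
  where
  open ≡-Reasoning
  lo = ⌈ l₁ ⊔ l₂ /2⌉
  m  = suc (l₁ ⊓ l₂) ∸ lo
  X  = lo + (m + suc l₁)
  beyond-min : ∀ i → t (lo + (m + i)) l₁ l₂ ≡ 0
  beyond-min i = t-vanishes-above l₁ l₂ _
    (≤-trans (m≤n+m∸n (suc (l₁ ⊓ l₂)) lo) (+-monoʳ-≤ lo (m≤m+n m i)))

mainTheorem6 : (ℓ₁ ℓ₂ : ℕ) →
    Σ ℕ (λ n → (Mats S₆ ℓ₁ ℓ₂ ↔ Fin n) × (+ n ≡ formula ℓ₁ ℓ₂))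
mainTheorem6 ℓ₁ ℓ₂ = N ℓ₁ ℓ₂ , Mats↔Fin ℓ₁ ℓ₂ , N≡formula ℓ₁ ℓ₂
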